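{- Let $k$ be a positive integer. For any graph $H=(W,F)$ there exists a graph $G$ containing $W$ among its vertices such that the subgraph of $G$ induced by $W$ is isomorphic to $H$ and $W$ is a minimum $k$-PVC for $G$.
   Context: All graphs are finite and simple. For a graph $G=(V,E)$ and a positive integer $k$, a $k$-path vertex cover ($k$-PVC) of $G$ is a set $S\subseteq V$ such that every path on $k$ vertices in $G$ contains at least one vertex of $S$; it is minimum if it has minimum cardinality among all $k$-PVCs of $G$. -}

module Defs where

open import Data.Nat using (ℕ; suc; _≤_)
open import Data.Bool using (Bool; true; false)
open import Data.Fin using (Fin; toℕ)
open import Data.Fin.Subset using (Subset; _∈_; ∣_∣)
open import Data.Product using (Σ; ∃; _×_)
open import Relation.Binary.PropositionalEquality using (_≡_)
open import Function.Definitions using (Injective)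
open import Function.Bundles using (_⇔_)

record Graph (n : ℕ) : Set where
  field
    adj    : Fin n → Fin n → Bool
    sym    : ∀ x y → adj x y ≡ adj y x
    irrefl : ∀ x → adj x x ≡ false
open Graph public

IsPath : ∀ {n} → Graph n → (k : ℕ) → (Fin k → Fin n) → Set
IsPath G k p =
  Injective _≡_ _≡_ p ×
  (∀ (i j : Fin k) → toℕ j ≡ suc (toℕ i) → adj G (p i) (p j) ≡ true)

IsPVC : ∀ {n} → (k : ℕ) → Graph n → Subset n → Set
IsPVC {n} k G S = ∀ (p : Fin k → Fin n) → IsPath G k p → ∃ λ i → p i ∈ S

IsMinimumPVC : ∀ {n} → (k : ℕ) → Graph n → Subset n → Set
IsMinimumPVC {n} k G S =
  IsPVC k G S × (∀ (T : Subset n) → IsPVC k G T → ∣ S ∣ ≤ ∣ T ∣)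

-- The subgraph of G induced by W is isomorphic to H, witnessed by a map
-- f : V(H) → V(G) that is injective, has image exactly W, and preserves
-- and reflects adjacency.
InducedIso : ∀ {m n} → Graph m → Graph n → Subset n → (Fin m → Fin n) → Set
InducedIso {m} {n} H G W f =
  Injective _≡_ _≡_ f ×
  (∀ (x : Fin n) → (x ∈ W) ⇔ (∃ λ i → f i ≡ x)) ×
  (∀ (i j : Fin m) → adj H i j ≡ adj G (f i) (f j))

-- Construction: the rooted product of H with a rooted graph P on K = k
-- vertices, i.e. a copy P_i of P for every vertex i of H, where the root
-- (i , r) of P_i plays the role of i and carries the edges of H.  The root
-- layer W = {(i , r)} induces a copy of H.
--
--  * W is a K-PVC: a path avoiding W only uses non-root vertices, which are
--    adjacent only inside a single copy P_i; so it lives injectively in the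
--    K - 1 non-root vertices of P_i and has fewer than K vertices.
--  * W is minimum when P has a Hamiltonian path: the m copies of that path
--    are disjoint K-paths, so every K-PVC T admits an injection from the
--    vertices of H into T, whence ∣ W ∣ ≤ m ≤ ∣ T ∣.
module Submission where

open import Defs hiding (sym)
open import Data.Nat using (ℕ; zero; suc; _+_; _*_; _≤_; z≤n; s≤s)
import Data.Nat.Properties as ℕ
open import Data.Bool using (Bool; true; false; _∧_; _∨_)
open import Data.Bool.Properties using (∧-comm; ∧-zeroʳ; ∨-comm; ∨-zeroʳ; ∨-identityʳ)
open import Data.Fin using (Fin; zero; suc; toℕ; combine; remQuot; quotient; remainder; punchOut; _≟_)
open import Data.Fin.Properties
  using (any?; injective⇒≤; 0≢1+n; suc-injective; combine-injectiveˡ; combine-injectiveʳ;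
         combine-remQuot; remQuot-combine; punchOut-injective)
open import Data.Fin.Subset using (Subset; _∈_; ∣_∣; _∪_; ⁅_⁆; ⊥; _-_)
open import Data.Fin.Subset.Properties
  using (_∈?_; ∉⊥; x∈⁅x⁆; x∈⁅y⁆⇒x≡y; x∈p∪q⁻; x∈p∪q⁺; ∣⊥∣≡0; ∣⁅x⁆∣≡1;
         x∈p∧x≢y⇒x∈p-y; x∈p⇒∣p-x∣<∣p∣)
open import Data.Product using (Σ; ∃; _×_; _,_; proj₁; proj₂)
open import Data.Sum using (inj₁; inj₂)
open import Data.Vec using (_∷_; [])
open import Function using (_∘_; id)
open import Function.Bundles using (_⇔_; mk⇔; Equivalence)
open import Function.Definitions using (Injective)
open import Relation.Nullary using (¬_; does; yes; no; contradiction)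
open import Relation.Nullary.Decidable using (dec-true; dec-false)
open import Relation.Binary.PropositionalEquality
  using (_≡_; _≢_; refl; sym; trans; cong; cong₂)

_==_ : ∀ {n} → Fin n → Fin n → Bool
i == j = does (i ≟ j)

==-sym : ∀ {n} (i j : Fin n) → i == j ≡ j == i
==-sym i j with i ≟ j | j ≟ i
... | yes _   | yes _   = refl
... | no _    | no _    = refl
... | yes i≡j | no j≢i  = contradiction (sym i≡j) j≢i
... | no i≢j  | yes j≡i = contradiction (sym j≡i) i≢j

image : ∀ {m n} → (Fin m → Fin n) → Subset n
image {zero}  g = ⊥
image {suc m} g = ⁅ g zero ⁆ ∪ image (g ∘ suc)

∈-image : ∀ {m n} (g : Fin m → Fin n) (x : Fin n) →
          (x ∈ image g) ⇔ (∃ λ i → g i ≡ x)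
∈-image {zero}  g x = mk⇔ (λ x∈⊥ → contradiction x∈⊥ ∉⊥) (λ { (() , _) })
∈-image {suc m} g x = mk⇔ to from
  where
  rest : (x ∈ image (g ∘ suc)) ⇔ (∃ λ i → g (suc i) ≡ x)
  rest = ∈-image (g ∘ suc) x
  to : x ∈ image g → ∃ λ i → g i ≡ x
  to x∈ with x∈p∪q⁻ ⁅ g zero ⁆ (image (g ∘ suc)) x∈
  ... | inj₁ x∈⁅g0⁆ = zero , sym (x∈⁅y⁆⇒x≡y (g zero) x∈⁅g0⁆)
  ... | inj₂ x∈rest with Equivalence.to rest x∈rest
  ...   | i , gi≡x = suc i , gi≡x
  from : (∃ λ i → g i ≡ x) → x ∈ image g
  from (zero  , refl) = x∈p∪q⁺ (inj₁ (x∈⁅x⁆ (g zero)))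
  from (suc i , gi≡x) = x∈p∪q⁺ {p = ⁅ g zero ⁆} (inj₂ (Equivalence.from rest (i , gi≡x)))

∣p∪q∣≤∣p∣+∣q∣ : ∀ {n} (p q : Subset n) → ∣ p ∪ q ∣ ≤ ∣ p ∣ + ∣ q ∣
∣p∪q∣≤∣p∣+∣q∣ []            []            = z≤n
∣p∪q∣≤∣p∣+∣q∣ (true  ∷ p) (true  ∷ q) =
  s≤s (ℕ.≤-trans (∣p∪q∣≤∣p∣+∣q∣ p q) (ℕ.+-monoʳ-≤ ∣ p ∣ (ℕ.n≤1+n ∣ q ∣)))
∣p∪q∣≤∣p∣+∣q∣ (true  ∷ p) (false ∷ q) = s≤s (∣p∪q∣≤∣p∣+∣q∣ p q)
∣p∪q∣≤∣p∣+∣q∣ (false ∷ p) (true  ∷ q) =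
  ℕ.≤-trans (s≤s (∣p∪q∣≤∣p∣+∣q∣ p q)) (ℕ.≤-reflexive (sym (ℕ.+-suc ∣ p ∣ ∣ q ∣)))
∣p∪q∣≤∣p∣+∣q∣ (false ∷ p) (false ∷ q) = ∣p∪q∣≤∣p∣+∣q∣ p q

∣image∣≤ : ∀ {m n} (g : Fin m → Fin n) → ∣ image g ∣ ≤ m
∣image∣≤ {zero}  {n} g = ℕ.≤-reflexive (∣⊥∣≡0 n)
∣image∣≤ {suc m}     g = begin
  ∣ ⁅ g zero ⁆ ∪ image (g ∘ suc) ∣     ≤⟨ ∣p∪q∣≤∣p∣+∣q∣ ⁅ g zero ⁆ (image (g ∘ suc)) ⟩
  ∣ ⁅ g zero ⁆ ∣ + ∣ image (g ∘ suc) ∣ ≡⟨ cong (_+ ∣ image (g ∘ suc) ∣) (∣⁅x⁆∣≡1 (g zero)) ⟩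
  suc ∣ image (g ∘ suc) ∣              ≤⟨ s≤s (∣image∣≤ (g ∘ suc)) ⟩
  suc m                                ∎
  where open ℕ.≤-Reasoning

-- An injection of m points into T forces m ≤ ∣ T ∣: remove g zero from T
-- (which strictly shrinks T) and recurse on the remaining points.
injection⇒≤∣∣ : ∀ {m n} (T : Subset n) (g : Fin m → Fin n) →
                Injective _≡_ _≡_ g → (∀ i → g i ∈ T) → m ≤ ∣ T ∣
injection⇒≤∣∣ {zero}  T g g-inj g∈T = z≤n
injection⇒≤∣∣ {suc m} T g g-inj g∈T =
  ℕ.≤-trans (s≤s (injection⇒≤∣∣ (T - g zero) (g ∘ suc) (suc-injective ∘ g-inj) g∘suc∈T-g0))
            (x∈p⇒∣p-x∣<∣p∣ (g∈T zero))
  where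
  g∘suc∈T-g0 : ∀ i → g (suc i) ∈ T - g zero
  g∘suc∈T-g0 i = x∈p∧x≢y⇒x∈p-y (g∈T (suc i)) (λ e → 0≢1+n (sym (g-inj e)))

constant-along-path : ∀ {k} {A : Set} (g : Fin (suc k) → A) →
  (∀ i j → toℕ j ≡ suc (toℕ i) → g i ≡ g j) → ∀ t → g t ≡ g zero
constant-along-path         g step zero    = refl
constant-along-path {suc k} g step (suc t) =
  trans (constant-along-path (g ∘ suc) (λ i j e → step (suc i) (suc j) (cong suc e)) t)
        (sym (step zero (suc zero) refl))

pathGraph : (k : ℕ) → Graph k
pathGraph k = record
  { adj    = λ a b → does (suc (toℕ a) ℕ.≟ toℕ b) ∨ does (suc (toℕ b) ℕ.≟ toℕ a)
  ; sym    = λ a b → ∨-comm (does (suc (toℕ a) ℕ.≟ toℕ b)) _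
  ; irrefl = λ a → cong₂ _∨_ (not-succ a) (not-succ a)
  }
  where
  not-succ : (a : Fin k) → does (suc (toℕ a) ℕ.≟ toℕ a) ≡ false
  not-succ a = dec-false (suc (toℕ a) ℕ.≟ toℕ a) ℕ.1+n≢n

pathGraph-path : (k : ℕ) → IsPath (pathGraph k) k id
pathGraph-path k = id , consecutive
  where
  consecutive : ∀ (i j : Fin k) → toℕ j ≡ suc (toℕ i) → adj (pathGraph k) i j ≡ true
  consecutive i j j≡1+i rewrite dec-true (suc (toℕ i) ℕ.≟ toℕ j) (sym j≡1+i) = refl

module RootedProduct {m K′ : ℕ} (H : Graph m) (P : Graph (suc K′)) (r : Fin (suc K′)) where

  K : ℕ
  K = suc K′

  adjPair : Fin m × Fin K → Fin m × Fin K → Bool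
  adjPair (i , a) (j , b) = ((a == r ∧ b == r) ∧ adj H i j) ∨ (i == j ∧ adj P a b)

  product : Graph (m * K)
  product = record
    { adj    = λ x y → adjPair (remQuot K x) (remQuot K y)
    ; sym    = λ x y → adjPair-sym (remQuot K x) (remQuot K y)
    ; irrefl = λ x → adjPair-irrefl (remQuot K x)
    }
    where
    adjPair-sym : ∀ u v → adjPair u v ≡ adjPair v u
    adjPair-sym (i , a) (j , b) =
      cong₂ _∨_ (cong₂ _∧_ (∧-comm (a == r) (b == r)) (Graph.sym H i j))
                (cong₂ _∧_ (==-sym i j) (Graph.sym P a b))
    adjPair-irrefl : ∀ u → adjPair u u ≡ false
    adjPair-irrefl (i , a) =
      cong₂ _∨_ (trans (cong ((a == r ∧ a == r) ∧_) (irrefl H i)) (∧-zeroʳ _))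
                (trans (cong (i == i ∧_) (irrefl P a)) (∧-zeroʳ _))

  block : Fin (m * K) → Fin m
  block = quotient K

  layer : Fin (m * K) → Fin K
  layer = remainder {m} K

  block-layer-injective : ∀ {x y} → block x ≡ block y → layer x ≡ layer y → x ≡ y
  block-layer-injective {x} {y} bx≡by lx≡ly =
    trans (sym (combine-remQuot {m} K x))
          (trans (cong₂ combine bx≡by lx≡ly) (combine-remQuot {m} K y))

  adj-combine : ∀ i a j b → adj product (combine i a) (combine j b) ≡ adjPair (i , a) (j , b)
  adj-combine i a j b = cong₂ adjPair (remQuot-combine i a) (remQuot-combine j b)

  root-edge : ∀ i j → adjPair (i , r) (j , r) ≡ adj H i j
  root-edge i j rewrite dec-true (r ≟ r) refl | irrefl P r | ∧-zeroʳ (i == j) =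
    ∨-identityʳ (adj H i j)

  fibre-edge : ∀ i {a b} → adj P a b ≡ true → adjPair (i , a) (i , b) ≡ true
  fibre-edge i {a} {b} a~b rewrite a~b | dec-true (i ≟ i) refl = ∨-zeroʳ _

  nonroot-edge : ∀ {i j a b} → a ≢ r → adjPair (i , a) (j , b) ≡ true → i ≡ j
  nonroot-edge {i} {j} {a} a≢r e with a ≟ r | i ≟ j
  ... | yes a≡r | _       = contradiction a≡r a≢r
  ... | no _    | yes i≡j = i≡j
  nonroot-edge a≢r () | no _ | no _

  root : Fin m → Fin (m * K)
  root i = combine i r

  rootLayer : Subset (m * K)
  rootLayer = image root

  rootLayer-induces-H : InducedIso H product rootLayer root
  rootLayer-induces-H =
      (λ {i} {j} e → combine-injectiveˡ i r j r e)
    , ∈-image root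
    , λ i j → sym (trans (adj-combine i r j r) (root-edge i j))

  ∉rootLayer⇒nonroot : ∀ x → ¬ (x ∈ rootLayer) → layer x ≢ r
  ∉rootLayer⇒nonroot x x∉W lx≡r = x∉W (Equivalence.from (∈-image root x) (block x , root-bx≡x))
    where
    root-bx≡x : root (block x) ≡ x
    root-bx≡x = block-layer-injective (cong proj₁ (remQuot-combine (block x) r))
                  (trans (cong proj₂ (remQuot-combine (block x) r)) (sym lx≡r))

  -- The root layer is a K-PVC: a K-path avoiding it would stay in one fibre
  -- and map injectively into the K - 1 non-root vertices of P.
  rootLayer-PVC : IsPVC K product rootLayer
  rootLayer-PVC p (p-inj , p-adj) with any? (λ t → p t ∈? rootLayer)
  ... | yes hit  = hit
  ... | no ¬hit  = contradiction (injective⇒≤ squeeze-inj) ℕ.1+n≰n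
    where
    nonroot : ∀ t → layer (p t) ≢ r
    nonroot t = ∉rootLayer⇒nonroot (p t) (λ p∈W → ¬hit (t , p∈W))
    same-block : ∀ t → block (p t) ≡ block (p zero)
    same-block = constant-along-path (block ∘ p)
      (λ i j j≡1+i → nonroot-edge (nonroot i) (p-adj i j j≡1+i))
    r≢layer : ∀ t → r ≢ layer (p t)
    r≢layer t = nonroot t ∘ sym
    -- The layers of the path, renumbered among the K′ non-root vertices of P.
    squeeze : Fin K → Fin K′
    squeeze t = punchOut (r≢layer t)
    squeeze-inj : Injective _≡_ _≡_ squeeze
    squeeze-inj {t} {u} e = p-inj (block-layer-injective
      (trans (same-block t) (sym (same-block u)))
      (punchOut-injective (r≢layer t) (r≢layer u) e))

  -- If P has a Hamiltonian path q, its m copies (one per fibre) are disjoint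
  -- K-paths, so every K-PVC contains one vertex from each fibre.
  rootLayer-minimum : ∀ {q} → IsPath P K q → IsMinimumPVC K product rootLayer
  rootLayer-minimum {q} (q-inj , q-adj) = rootLayer-PVC , minimum
    where
    fibre-path : ∀ i → IsPath product K (combine i ∘ q)
    fibre-path i =
        (λ {t} {u} e → q-inj (combine-injectiveʳ i (q t) i (q u) e))
      , λ t u u≡1+t → trans (adj-combine i (q t) i (q u)) (fibre-edge i (q-adj t u u≡1+t))
    minimum : ∀ T → IsPVC K product T → ∣ rootLayer ∣ ≤ ∣ T ∣
    minimum T T-PVC = ℕ.≤-trans (∣image∣≤ root) (injection⇒≤∣∣ T hit hit-inj hit∈T)
      where
      hit : Fin m → Fin (m * K)
      hit i = combine i (q (proj₁ (T-PVC (combine i ∘ q) (fibre-path i))))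
      hit-inj : Injective _≡_ _≡_ hit
      hit-inj {i} {j} e = combine-injectiveˡ i _ j _ e
      hit∈T : ∀ i → hit i ∈ T
      hit∈T i = proj₂ (T-PVC (combine i ∘ q) (fibre-path i))

-- Take the rooted product of H with the path P_k rooted at an end vertex.
mainTheorem6 : (k : ℕ) → 1 ≤ k → (m : ℕ) → (H : Graph m) →
    Σ ℕ λ n → Σ (Graph n) λ G → Σ (Subset n) λ W → Σ (Fin m → Fin n) λ f →
    InducedIso H G W f × IsMinimumPVC k G W
mainTheorem6 (suc k′) _ m H =
  _ , product , rootLayer , root , rootLayer-induces-H , rootLayer-minimum (pathGraph-path (suc k′))
  where open RootedProduct H (pathGraph (suc k′)) zero
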